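{- Let $\Gamma$ be a context and $A,B$ $\lambda\alpha$-terms such that $\Gamma\vdash A\longrightarrow a$, $A\twoheadrightarrow B$ by zero or more steps of $\sigma\cup\{\mathrm{Beta}\}$, and $\Gamma\vdash B\longrightarrow b$. Then $a\twoheadrightarrow b$ in $\lambda\upsilon'$.
   Context: Variables $x,y,z,\ldots$; $\mathsf{x},\mathsf{y},\mathsf{z}$ range over variables. Terms and substitutions of $\lambda\alpha$: $A,B::=\mathsf{x}\mid AB\mid\lambda\mathsf{x}.A\mid S\circ A$, $S::=[B/\mathsf{x}]\mid W\mathsf{x}\mid\{\mathsf{y}\mathsf{x}\}\mid S_{\mathsf{x}}$; $S_1\circ S_2\circ A$ means $S_1\circ(S_2\circ A)$, $S\circ AB$ means $S\circ(AB)$, $\lambda\mathsf{x}.S\circ A$ means $\lambda\mathsf{x}.(S\circ A)$. A context $\Gamma$ is a pair $G,L$ of a finite set $G$ of variables and a finite list $L$ of variables with repetitions allowed; $\Gamma,\mathsf{x}$ denotes $G,(L,\mathsf{x})$; a context with empty list is written $G$. The system $\sigma\cup\{\mathrm{Beta}\}$ consists of the following rules, applicable in any subterm position (under $\lambda\mathsf{x}.$, either side of application, either component of $S\circ A$, inside $B$ of $[B/\mathsf{x}]$, inside $S$ of $S_{\mathsf{x}}$): $(\lambda\mathsf{x}.A)B\to[B/\mathsf{x}]\circ A$; $S\circ AB\to(S\circ A)(S\circ B)$; $S\circ\lambda\mathsf{x}.A\to\lambda\mathsf{x}.S_{\mathsf{x}}\circ A$; $[B/\mathsf{x}]\circ\mathsf{x}\to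 B$; $[B/\mathsf{x}]\circ W\mathsf{x}\circ A\to A$; $[B/\mathsf{x}]\circ\mathsf{z}\to\mathsf{z}$ ($\mathsf{x}\neq\mathsf{z}$); $\{\mathsf{y}\mathsf{x}\}\circ\mathsf{x}\to\mathsf{y}$; $\{\mathsf{y}\mathsf{x}\}\circ W\mathsf{x}\circ A\to W\mathsf{y}\circ A$; $\{\mathsf{y}\mathsf{x}\}\circ\mathsf{z}\to W\mathsf{y}\circ\mathsf{z}$ ($\mathsf{x}\neq\mathsf{z}$); $S_{\mathsf{x}}\circ\mathsf{x}\to\mathsf{x}$; $S_{\mathsf{x}}\circ W\mathsf{x}\circ A\to W\mathsf{x}\circ S\circ A$; $S_{\mathsf{x}}\circ\mathsf{z}\to W\mathsf{x}\circ S\circ\mathsf{z}$ ($\mathsf{x}\neq\mathsf{z}$); $W\mathsf{x}\circ\mathsf{z}\to\mathsf{z}$ ($\mathsf{x}\neq\mathsf{z}$). $\lambda\upsilon'$: terms $a,b::=\mathsf{x}\mid\underline{1}\mid ab\mid\lambda a\mid a[s]$, substitutions $s::=b/\mid\,\uparrow\,\mid id\mid\,\Uparrow\! s$; $a[s][t]$ means $(a[s])[t]$; rules (applicable to any subterm, including inside $b/$ and $\Uparrow\! s$): $(\lambda a)b\to a[b/]$; $(ab)[s]\to(a[s])(b[s])$; $(\lambda a)[s]\to\lambda(a[\Uparrow\! s])$; $\underline{1}[b/]\to b$; $a[\uparrow][b/]\to a$; $\underline{1}[id]\to\underline{1}$; $a[\uparrow][id]\to a[\uparrow]$; $\underline{1}[\Uparrow\!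 s]\to\underline{1}$; $a[\uparrow][\Uparrow\! s]\to a[s][\uparrow]$; $\twoheadrightarrow$ is the reflexive-transitive closure. Translation: the relations $\Gamma\vdash A\longrightarrow a$ and $\Gamma\vdash S\triangleright\Delta\longrightarrow s$ are inductively defined by: $G\vdash\mathsf{x}\longrightarrow\mathsf{x}$ if $\mathsf{x}\in G$; $\Gamma,\mathsf{x}\vdash\mathsf{x}\longrightarrow\underline{1}$; from $\Gamma\vdash\mathsf{x}\longrightarrow a$ and $\mathsf{x}\neq\mathsf{y}$ infer $\Gamma,\mathsf{y}\vdash\mathsf{x}\longrightarrow a[\uparrow]$; from $\Gamma\vdash A\longrightarrow a$, $\Gamma\vdash B\longrightarrow b$ infer $\Gamma\vdash AB\longrightarrow ab$; from $\Gamma,\mathsf{x}\vdash A\longrightarrow a$ infer $\Gamma\vdash\lambda\mathsf{x}.A\longrightarrow\lambda a$; from $\Gamma\vdash S\triangleright\Delta\longrightarrow s$, $\Delta\vdash A\longrightarrow a$ infer $\Gamma\vdash S\circ A\longrightarrow a[s]$; from $\Gamma\vdash B\longrightarrow b$ infer $\Gamma\vdash[B/\mathsf{x}]\triangleright\Gamma,\mathsf{x}\longrightarrow b/$; $\Gamma,\mathsf{x}\vdash W\mathsf{x}\triangleright\Gamma\longrightarrow\,\uparrow$; $\Gamma,\mathsf{y}\vdash\{\mathsf{y}\mathsf{x}\}\triangleright\Gamma,\mathsf{x}\longrightarrow id$; from $\Gamma\vdash S\triangleright\Delta\longrightarrow s$ infer $\Gamma,\mathsf{x}\vdash S_{\mathsf{x}}\triangleright\Delta,\mathsf{x}\longrightarrow\,\Uparrow\!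 s$. -}

module Defs where

open import Data.Nat using (ℕ)
open import Data.List using (List)
open import Data.List.Membership.Propositional using (_∈_)
open import Relation.Binary.PropositionalEquality using (_≡_)
open import Relation.Nullary using (¬_)
open import Relation.Binary.Construct.Closure.ReflexiveTransitive using (Star)

Var : Set
Var = ℕ

mutual
  data Tm : Set where
    var  : Var → Tm
    app  : Tm → Tm → Tm
    lam  : Var → Tm → Tm
    _∘_  : Sb → Tm → Tm

  data Sb : Set where
    [_/_] : Tm → Var → Sb
    W     : Var → Sb
    ren   : Var → Var → Sb          -- {y x}  written ren y x
    lift  : Sb → Var → Sb           -- S_x   written lift S x

infixr 5 _∘_

-- one step of σ ∪ {Beta}, closed under all subterm positions
mutual
  data _⟶α_ : Tm → Tm → Set where
    Beta   : ∀ {x A B} → app (lam x A) B ⟶α ([ B / x ] ∘ A)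
    App    : ∀ {S A B} → (S ∘ app A B) ⟶α app (S ∘ A) (S ∘ B)
    Lambda : ∀ {S x A} → (S ∘ lam x A) ⟶α lam x (lift S x ∘ A)
    VarSub : ∀ {B x} → ([ B / x ] ∘ var x) ⟶α B
    WSub   : ∀ {B x A} → ([ B / x ] ∘ W x ∘ A) ⟶α A
    VarSubOther : ∀ {B x z} → ¬ x ≡ z → ([ B / x ] ∘ var z) ⟶α var z
    VarRen : ∀ {y x} → (ren y x ∘ var x) ⟶α var y
    WRen   : ∀ {y x A} → (ren y x ∘ W x ∘ A) ⟶α (W y ∘ A)
    VarRenOther : ∀ {y x z} → ¬ x ≡ z → (ren y x ∘ var z) ⟶α (W y ∘ var z)
    VarLift : ∀ {S x} → (lift S x ∘ var x) ⟶α var x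
    WLift   : ∀ {S x A} → (lift S x ∘ W x ∘ A) ⟶α (W x ∘ S ∘ A)
    VarLiftOther : ∀ {S x z} → ¬ x ≡ z → (lift S x ∘ var z) ⟶α (W x ∘ S ∘ var z)
    VarWOther : ∀ {x z} → ¬ x ≡ z → (W x ∘ var z) ⟶α var z
    cLam  : ∀ {x A A'} → A ⟶α A' → lam x A ⟶α lam x A'
    cAppL : ∀ {A A' B} → A ⟶α A' → app A B ⟶α app A' B
    cAppR : ∀ {A B B'} → B ⟶α B' → app A B ⟶α app A B'
    cSubS : ∀ {S S' A} → S ⟶αs S' → (S ∘ A) ⟶α (S' ∘ A)
    cSubT : ∀ {S A A'} → A ⟶α A' → (S ∘ A) ⟶α (S ∘ A')

  data _⟶αs_ : Sb → Sb → Set where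
    cCons : ∀ {B B' x} → B ⟶α B' → [ B / x ] ⟶αs [ B' / x ]
    cLift : ∀ {S S' x} → S ⟶αs S' → lift S x ⟶αs lift S' x

_↠α_ : Tm → Tm → Set
_↠α_ = Star _⟶α_

mutual
  data Tmυ : Set where
    fvar : Var → Tmυ               -- named (global) variable x
    one  : Tmυ
    app  : Tmυ → Tmυ → Tmυ
    lam  : Tmυ → Tmυ
    _[_] : Tmυ → Sbυ → Tmυ

  data Sbυ : Set where
    _/   : Tmυ → Sbυ
    ↑    : Sbυ
    idυ  : Sbυ
    ⇑    : Sbυ → Sbυ

mutual
  data _⟶υ_ : Tmυ → Tmυ → Set where
    Beta  : ∀ {a b} → app (lam a) b ⟶υ (a [ b / ])
    App   : ∀ {a b s} → (app a b [ s ]) ⟶υ app (a [ s ]) (b [ s ])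
    Lam   : ∀ {a s} → (lam a [ s ]) ⟶υ lam (a [ ⇑ s ])
    FVar  : ∀ {b} → (one [ b / ]) ⟶υ b
    RVar  : ∀ {a b} → (a [ ↑ ] [ b / ]) ⟶υ a
    FVarId : (one [ idυ ]) ⟶υ one
    RVarId : ∀ {a} → (a [ ↑ ] [ idυ ]) ⟶υ (a [ ↑ ])
    FVarLift : ∀ {s} → (one [ ⇑ s ]) ⟶υ one
    RVarLift : ∀ {a s} → (a [ ↑ ] [ ⇑ s ]) ⟶υ (a [ s ] [ ↑ ])
    cLam  : ∀ {a a'} → a ⟶υ a' → lam a ⟶υ lam a'
    cAppL : ∀ {a a' b} → a ⟶υ a' → app a b ⟶υ app a' b
    cAppR : ∀ {a b b'} → b ⟶υ b' → app a b ⟶υ app a b'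
    cSubT : ∀ {a a' s} → a ⟶υ a' → (a [ s ]) ⟶υ (a' [ s ])
    cSubS : ∀ {a s s'} → s ⟶υs s' → (a [ s ]) ⟶υ (a [ s' ])

  data _⟶υs_ : Sbυ → Sbυ → Set where
    cCons : ∀ {b b'} → b ⟶υ b' → (b /) ⟶υs (b' /)
    cLift : ∀ {s s'} → s ⟶υs s' → ⇑ s ⟶υs ⇑ s'

infixl 8 _[_]

_↠υ_ : Tmυ → Tmυ → Set
_↠υ_ = Star _⟶υ_

-- Contexts: a finite set G (a list, used only through membership)
-- and a list L of variables; Γ , x appends x at the end of L.

data VList : Set where
  ε   : VList
  _▸_ : VList → Var → VList

record Ctx : Set where
  constructor ⟨_∣_⟩
  field
    glob : List Var
    loc  : VList

_,,_ : Ctx → Var → Ctx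
⟨ G ∣ L ⟩ ,, x = ⟨ G ∣ L ▸ x ⟩

infixl 5 _,,_

mutual
  data _⊢_⟶_ : Ctx → Tm → Tmυ → Set where
    tGlob : ∀ {G x} → x ∈ G → ⟨ G ∣ ε ⟩ ⊢ var x ⟶ fvar x
    tOne  : ∀ {Γ x} → (Γ ,, x) ⊢ var x ⟶ one
    tShift : ∀ {Γ x y a} → Γ ⊢ var x ⟶ a → ¬ x ≡ y → (Γ ,, y) ⊢ var x ⟶ (a [ ↑ ])
    tApp  : ∀ {Γ A B a b} → Γ ⊢ A ⟶ a → Γ ⊢ B ⟶ b → Γ ⊢ app A B ⟶ app a b
    tLam  : ∀ {Γ x A a} → (Γ ,, x) ⊢ A ⟶ a → Γ ⊢ lam x A ⟶ lam a
    tSub  : ∀ {Γ Δ S A s a} → Γ ⊢ S ▹ Δ ⟶ s → Δ ⊢ A ⟶ a → Γ ⊢ (S ∘ A) ⟶ (a [ s ])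

  data _⊢_▹_⟶_ : Ctx → Sb → Ctx → Sbυ → Set where
    tCons : ∀ {Γ B b x} → Γ ⊢ B ⟶ b → Γ ⊢ [ B / x ] ▹ (Γ ,, x) ⟶ (b /)
    tW    : ∀ {Γ x} → (Γ ,, x) ⊢ W x ▹ Γ ⟶ ↑
    tRen  : ∀ {Γ x y} → (Γ ,, y) ⊢ ren y x ▹ (Γ ,, x) ⟶ idυ
    tLift : ∀ {Γ Δ S s x} → Γ ⊢ S ▹ Δ ⟶ s → (Γ ,, x) ⊢ lift S x ▹ (Δ ,, x) ⟶ ⇑ s

-- The proof is a simulation argument through the translation relation.
--  * One step: if Γ ⊢ A ⟶ a and A ⟶α B, then B has a translation b in the
--    same context Γ with a ↠υ b.  Every rule of σ ∪ {Beta} is matched by at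
--    most one λυ' rule at the root (the rule W x ∘ z → z by zero steps, since
--    both sides translate to the same term), and the congruence cases follow
--    by lifting reduction sequences through the corresponding λυ' contexts.
--    The case analysis runs mutually over terms and substitutions.
--  * Many steps: iterate the one-step simulation along A ↠α B.
--  * Determinism: the translation relation is functional, so the translation
--    of B produced by the simulation is the given b, which yields the theorem.
module Submission where

open import Defs
open import Data.Product using (Σ-syntax; _×_; _,_)
open import Data.Empty using (⊥-elim)
open import Relation.Binary.PropositionalEquality using (_≡_; refl; sym; cong; cong₂)
open import Relation.Binary.Construct.Closure.ReflexiveTransitive
  using (Star; ε; _◅_; _◅◅_; gmap; return)

_↠υs_ : Sbυ → Sbυ → Set
_↠υs_ = Star _⟶υs_

Reachable : Ctx → Tm → Tmυ → Set
Reachable Γ B a = Σ[ b ∈ Tmυ ] (Γ ⊢ B ⟶ b) × (a ↠υ b)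

ReachableS : Ctx → Sb → Ctx → Sbυ → Set
ReachableS Γ S Δ s = Σ[ s' ∈ Sbυ ] (Γ ⊢ S ▹ Δ ⟶ s') × (s ↠υs s')

mutual
  simulateStep : ∀ {Γ A B a} → Γ ⊢ A ⟶ a → A ⟶α B → Reachable Γ B a
  simulateStep (tApp (tLam ta) tb) Beta = _ , tSub (tCons tb) ta , return Beta
  simulateStep (tSub ts (tApp ta tb)) App = _ , tApp (tSub ts ta) (tSub ts tb) , return App
  simulateStep (tSub ts (tLam ta)) Lambda = _ , tLam (tSub (tLift ts) ta) , return Lam
  simulateStep (tSub (tCons tb) tOne) VarSub = _ , tb , return FVar
  simulateStep (tSub (tCons tb) (tShift _ x≢x)) VarSub = ⊥-elim (x≢x refl)
  simulateStep (tSub (tCons tb) (tSub tW ta)) WSub = _ , ta , return RVar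
  simulateStep (tSub (tCons tb) tOne) (VarSubOther x≢x) = ⊥-elim (x≢x refl)
  simulateStep (tSub (tCons tb) (tShift tz _)) (VarSubOther _) = _ , tz , return RVar
  simulateStep (tSub tRen tOne) VarRen = _ , tOne , return FVarId
  simulateStep (tSub tRen (tShift _ x≢x)) VarRen = ⊥-elim (x≢x refl)
  simulateStep (tSub tRen (tSub tW ta)) WRen = _ , tSub tW ta , return RVarId
  simulateStep (tSub tRen tOne) (VarRenOther x≢x) = ⊥-elim (x≢x refl)
  simulateStep (tSub tRen (tShift tz _)) (VarRenOther _) = _ , tSub tW tz , return RVarId
  simulateStep (tSub (tLift ts) tOne) VarLift = _ , tOne , return FVarLift
  simulateStep (tSub (tLift ts) (tShift _ x≢x)) VarLift = ⊥-elim (x≢x refl)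
  simulateStep (tSub (tLift ts) (tSub tW ta)) WLift = _ , tSub tW (tSub ts ta) , return RVarLift
  simulateStep (tSub (tLift ts) tOne) (VarLiftOther x≢x) = ⊥-elim (x≢x refl)
  simulateStep (tSub (tLift ts) (tShift tz _)) (VarLiftOther _) =
    _ , tSub tW (tSub ts tz) , return RVarLift
  simulateStep (tSub tW tz) (VarWOther x≢z) = _ , tShift tz (λ z≡x → x≢z (sym z≡x)) , ε
  simulateStep (tLam ta) (cLam r) =
    let _ , ta' , rs = simulateStep ta r in _ , tLam ta' , gmap lam cLam rs
  simulateStep (tApp ta tb) (cAppL r) =
    let _ , ta' , rs = simulateStep ta r in _ , tApp ta' tb , gmap (λ a → app a _) cAppL rs
  simulateStep (tApp ta tb) (cAppR r) =
    let _ , tb' , rs = simulateStep tb r in _ , tApp ta tb' , gmap (app _) cAppR rs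
  simulateStep (tSub ts ta) (cSubS r) =
    let _ , ts' , rs = simulateStepS ts r in _ , tSub ts' ta , gmap (_ [_]) cSubS rs
  simulateStep (tSub ts ta) (cSubT r) =
    let _ , ta' , rs = simulateStep ta r in _ , tSub ts ta' , gmap (_[ _ ]) cSubT rs

  simulateStepS : ∀ {Γ Δ S S' s} → Γ ⊢ S ▹ Δ ⟶ s → S ⟶αs S' → ReachableS Γ S' Δ s
  simulateStepS (tCons tb) (cCons r) =
    let _ , tb' , rs = simulateStep tb r in _ , tCons tb' , gmap _/ cCons rs
  simulateStepS (tLift ts) (cLift r) =
    let _ , ts' , rs = simulateStepS ts r in _ , tLift ts' , gmap ⇑ cLift rs

simulate : ∀ {Γ A B a} → Γ ⊢ A ⟶ a → A ↠α B → Reachable Γ B a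
simulate ta ε = _ , ta , ε
simulate ta (r ◅ rs) =
  let _ , tb , xs = simulateStep ta r
      _ , tc , ys = simulate tb rs
  in _ , tc , xs ◅◅ ys

mutual
  translation-unique : ∀ {Γ A a a'} → Γ ⊢ A ⟶ a → Γ ⊢ A ⟶ a' → a ≡ a'
  translation-unique (tGlob _) (tGlob _) = refl
  translation-unique tOne tOne = refl
  translation-unique tOne (tShift _ x≢x) = ⊥-elim (x≢x refl)
  translation-unique (tShift _ x≢x) tOne = ⊥-elim (x≢x refl)
  translation-unique (tShift p _) (tShift p' _) = cong (_[ ↑ ]) (translation-unique p p')
  translation-unique (tApp p q) (tApp p' q') =
    cong₂ app (translation-unique p p') (translation-unique q q')
  translation-unique (tLam p) (tLam p') = cong lam (translation-unique p p')
  translation-unique (tSub ps p) (tSub ps' p') with translationS-unique ps ps'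
  ... | refl , refl = cong (_[ _ ]) (translation-unique p p')

  translationS-unique : ∀ {Γ S Δ Δ' s s'}
    → Γ ⊢ S ▹ Δ ⟶ s → Γ ⊢ S ▹ Δ' ⟶ s' → (Δ ≡ Δ') × (s ≡ s')
  translationS-unique (tCons p) (tCons p') = refl , cong _/ (translation-unique p p')
  translationS-unique tW tW = refl , refl
  translationS-unique tRen tRen = refl , refl
  translationS-unique (tLift p) (tLift p') with translationS-unique p p'
  ... | refl , refl = refl , refl

mainTheorem20 : (Γ : Ctx) (A B : Tm) (a b : Tmυ)
    → Γ ⊢ A ⟶ a → A ↠α B → Γ ⊢ B ⟶ b → a ↠υ b
mainTheorem20 Γ A B a b ta rs tb with simulate ta rs
... | b' , tb' , a↠b' with translation-unique tb' tb
... | refl = a↠b'
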